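{- Let $n\ge 1$ and let $M$ be a $\mathbf{c}\mathbf{d}$-monomial of degree $n$. A function $f:\{0,1,\dots,n\}\to\mathbb{Z}$ is admissible for $M$ if and only if $f(j)=i_j$ ($j=0,\dots,n$) for the integer sequence $i_n,\dots,i_0$ of some run for $M$ (as defined in the context).
   Context: Multidegree: for a degree-$n$ monomial $M$ in noncommuting variables $\mathbf{c}$ (degree 1), $\mathbf{d}$ (degree 2), $\operatorname{mdeg}(M)=(v_1,\dots,v_n)\in\{0,1\}^n$ is obtained by replacing, left to right, each $\mathbf{c}$ by $0$ and each $\mathbf{d}$ by $1,0$. Admissible functions: $f:\{0,\dots,n\}\to\mathbb{Z}$ is admissible for $M$ (with $\operatorname{mdeg}(M)=v$) if: $f(0)=0$, $f(n)=n$, $0\le f(i)\le i$ for $1\le i\le n-1$; if $v_i=0$ then $f(i-1)<f(i)$; if $v_i=1$ then $f(i-1)\ge f(i)$; if $v_i=1$ and $i>1$ then $f(i-1)-f(i)\le f(i-2)+1$. Runs: write $M$ as a word $w_1w_2\cdots w_n$ in letters $C,\partial$ by replacing, left to right, each $\mathbf{c}$ by $C$ and each $\mathbf{d}$ by $\partial C$ (so $w_i=\partial$ iff $v_i=1$). Consider formal symbols $\Pi_k\times\sigma_l$ and $\Pi_k\times\Pi_l$ ($k,l\ge0$) of dimension $k+l$ (standing for the fan over the boundary of a $(k+1)$-simplex times the fan of an $l$-dimensional simplicial cone, resp. a product of two simplex-boundary fans). A run for $M$ is a sequence $F_n,F_{n-1},\dots,F_0$ with $F_n=\Pi_n\times\sigma_0$,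 where $F_{m-1}$ is obtained from $F_m$ by the letter $w_m$ (letters processed in the order $w_n,w_{n-1},\dots,w_1$), together with choices, according to these rules (no other transitions are allowed): (i) $w_m=C$, $F_m=\Pi_k\times\sigma_l$: choose $1\le i\le k$; $F_{m-1}=\Pi_{i-1}\times\sigma_{k+l-i}$. (ii) $w_m=C$, $F_m=\Pi_k\times\Pi_l$: choose $(i,j)$ with $0\le i\le k$, $0\le j\le l$, $(i,j)\ne(0,0)$; $F_{m-1}=\Pi_{i+j-1}\times\sigma_{k+l-i-j}$. (iii) $w_m=\partial$, $F_m=\Pi_k\times\sigma_l$ with $l\ge1$: $F_{m-1}=\Pi_k\times\Pi_{l-1}$. Two runs are the same iff their fans and choices coincide. The integer sequence $i_n,\dots,i_0$ of a run is: $i_n=n$; if $F_{m-1}$ arises by rule (i) with choice $i$, then $i_{m-1}=i-1$; if by rule (ii) with choice $(i,j)$, then $i_{m-1}=i+j-1$; if $F_{m-1}=\Pi_k\times\Pi_{l-1}$ arises by rule (iii) from $\Pi_k\times\sigma_l$, then $i_{m-1}=k+j$ where $(i,j)$ is the choice made in the next step $F_{m-1}\to F_{m-2}$ (rule (ii)) if $m-1\ge1$, and $i_{m-1}=k$ if $m-1=0$. -}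

module Defs where

open import Data.Nat using (ℕ; zero; suc; _+_; _∸_; _≤_; _<?_)
open import Data.Integer as ℤ using (ℤ; +_)
open import Data.Fin using (Fin; fromℕ<)
open import Data.List using (List; []; _∷_; _++_)
open import Data.Product using (_×_)
open import Relation.Binary.PropositionalEquality using (_≡_)
open import Relation.Nullary using (¬_; yes; no)

data CD : Set where
  𝐜 𝐝 : CD

Monomial : Set
Monomial = List CD

degree : Monomial → ℕ
degree []       = 0
degree (𝐜 ∷ M) = 1 + degree M
degree (𝐝 ∷ M) = 2 + degree M

mdeg : Monomial → List ℕ
mdeg []       = []
mdeg (𝐜 ∷ M) = 0 ∷ mdeg M
mdeg (𝐝 ∷ M) = 1 ∷ 0 ∷ mdeg M

data Letter : Set where
  C ∂ : Letter

word : Monomial → List Letter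
word []       = []
word (𝐜 ∷ M) = C ∷ word M
word (𝐝 ∷ M) = ∂ ∷ C ∷ word M

-- 0-indexed lookup with a default value (only used within range)
at : {A : Set} → A → List A → ℕ → A
at d []       _       = d
at d (x ∷ xs) zero    = x
at d (x ∷ xs) (suc k) = at d xs k

-- v_i  (1-indexed, i = 1..n)
v : Monomial → ℕ → ℕ
v M i = at 0 (mdeg M) (i ∸ 1)

-- w_i  (1-indexed, i = 1..n)
w : Monomial → ℕ → Letter
w M i = at C (word M) (i ∸ 1)

-- value of f at a natural number index (0 outside {0..n}; only used in range)
ext : {n : ℕ} → (Fin (suc n) → ℤ) → ℕ → ℤ
ext {n} f k with k <? suc n
... | yes p = f (fromℕ< p)
... | no _  = + 0

record Admissible (n : ℕ) (M : Monomial) (f : Fin (suc n) → ℤ) : Set where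
  field
    at0     : ext f 0 ≡ + 0
    atn     : ext f n ≡ + n
    bounds  : ∀ i → 1 ≤ i → i ≤ n ∸ 1 → (+ 0 ℤ.≤ ext f i) × (ext f i ℤ.≤ + i)
    rise    : ∀ i → 1 ≤ i → i ≤ n → v M i ≡ 0 → ext f (i ∸ 1) ℤ.< ext f i
    fall    : ∀ i → 1 ≤ i → i ≤ n → v M i ≡ 1 → ext f i ℤ.≤ ext f (i ∸ 1)
    dropLim : ∀ i → 2 ≤ i → i ≤ n → v M i ≡ 1 →
              (ext f (i ∸ 1) ℤ.- ext f i) ℤ.≤ (ext f (i ∸ 2) ℤ.+ + 1)

-- ΠΣ k l  =  Π_k × σ_l ;   ΠΠ k l  =  Π_k × Π_l
data Fan : Set where
  ΠΣ ΠΠ : ℕ → ℕ → Fan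

data Choice : Set where
  none : Choice
  one  : ℕ → Choice
  two  : ℕ → ℕ → Choice

data Step : Letter → Fan → Choice → Fan → Set where
  ruleI   : ∀ {k l i} → 1 ≤ i → i ≤ k →
            Step C (ΠΣ k l) (one i) (ΠΣ (i ∸ 1) (k + l ∸ i))
  ruleII  : ∀ {k l i j} → i ≤ k → j ≤ l → ¬ (i ≡ 0 × j ≡ 0) →
            Step C (ΠΠ k l) (two i j) (ΠΣ (i + j ∸ 1) (k + l ∸ (i + j)))
  ruleIII : ∀ {k l} → Step ∂ (ΠΣ k (suc l)) none (ΠΠ k l)

-- A run for M (of degree n): fans F_n,...,F_0 (fan m = F_m) and the choice
-- (choice m) made in the step F_m → F_{m-1}, for m = 1..n.
-- Values of fan/choice outside these ranges are irrelevant.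
record Run (n : ℕ) (M : Monomial) : Set where
  field
    fan    : ℕ → Fan
    choice : ℕ → Choice
    start  : fan n ≡ ΠΣ n 0
    steps  : ∀ m → 1 ≤ m → m ≤ n → Step (w M m) (fan m) (choice m) (fan (m ∸ 1))

-- entry (choice producing F_j) F_j j (choice of step F_j → F_{j-1})
entry : Choice → Fan → ℕ → Choice → ℕ
entry (one i)   _        _       _           = i ∸ 1
entry (two i j) _        _       _           = i + j ∸ 1
entry none      (ΠΠ k _) zero    _           = k
entry none      (ΠΠ k _) (suc _) (two _ j)   = k + j
entry none      _        _       _           = 0   -- impossible in a run

seqOf : {n : ℕ} {M : Monomial} → Run n M → ℕ → ℕ
seqOf {n} r j with j <? n
... | yes _ = entry (Run.choice r (suc j)) (Run.fan r j) j (Run.choice r j)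
... | no _  = n

module Submission where

-- Both sides are first reduced to one ℕ-valued notion, Admissibleℕ: the
-- admissibility inequalities for a function g : ℕ → ℕ, phrased through the
-- letters w_i of the word of M instead of the multidegree v_i (v_i = 0 iff
-- w_i = C, v_i = 1 iff w_i = ∂).  Admissible functions are nonnegative, so
-- f is admissible iff g = ∣f∣ is ℕ-admissible (admissible⇒ℕ,
-- ℕ⇒admissible).
--
-- Each step lowers the dimension
-- of the fan by one, so dim F_m = m.  The sequence equals k on Π_k × σ_l and
-- lies between k and k + l on Π_k × Π_l; inverting the step F_{m+1} → F_m
-- against the letter w_{m+1} then yields the rise, fall and drop conditions.
--
-- From an ℕ-admissible g we write
-- down the fans and choices explicitly (F_m = Π_{g m} × σ_{m - g m} when
-- w_{m+1} = C, and Π_{g(m+1)} × Π_{m - g(m+1)} when w_{m+1} = ∂), check that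
-- each transition is an allowed step, and check that its sequence is g.

open import Defs
open import Data.Nat using (ℕ; suc; _≤_)
open import Data.Integer using (ℤ; +_)
open import Data.Fin using (Fin; toℕ)
open import Data.Product using (∃)
open import Function.Bundles using (_⇔_)
open import Relation.Binary.PropositionalEquality using (_≡_)

open import Data.Nat using (zero; _+_; _∸_; _<_; _<?_; z≤n; s≤s)
import Data.Nat.Properties as ℕP
import Data.Integer as ℤ
import Data.Integer.Properties as ℤP
open import Data.Fin using (fromℕ<)
import Data.Fin.Properties as FinP
open import Data.Product using (_×_; _,_; proj₁; proj₂)
open import Data.Sum using (inj₁; inj₂)
open import Data.Empty using (⊥; ⊥-elim)
open import Data.List using ([]; _∷_)
open import Relation.Nullary using (¬_; yes; no)
open import Relation.Binary.PropositionalEquality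
  using (_≢_; refl; sym; trans; cong; cong₂; subst; subst₂)
open import Function.Bundles using (mk⇔; Equivalence)
open import Algebra.Bundles using (AbelianGroup)
open import Algebra.Properties.Group (AbelianGroup.group ℤP.+-0-abelianGroup)
  using (//-rightDividesˡ; //-rightDividesʳ)

weight : Letter → ℕ
weight C = 0
weight ∂ = 1

-- The multidegree is the letterwise weight of the word (past the end of M
-- both lookups return their defaults, 0 and C, which also agree).
mdeg≡weight : ∀ M k → at 0 (mdeg M) k ≡ weight (at C (word M) k)
mdeg≡weight []      k             = refl
mdeg≡weight (𝐜 ∷ M) zero          = refl
mdeg≡weight (𝐜 ∷ M) (suc k)       = mdeg≡weight M k
mdeg≡weight (𝐝 ∷ M) zero          = refl
mdeg≡weight (𝐝 ∷ M) (suc zero)    = refl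
mdeg≡weight (𝐝 ∷ M) (suc (suc k)) = mdeg≡weight M k

w⇒v : ∀ M i {x} → w M i ≡ x → v M i ≡ weight x
w⇒v M i e = trans (mdeg≡weight M (i ∸ 1)) (cong weight e)

v≡0⇒C : ∀ M i → v M i ≡ 0 → w M i ≡ C
v≡0⇒C M i e with w M i | trans (sym (mdeg≡weight M (i ∸ 1))) e
... | C | _ = refl

v≡1⇒∂ : ∀ M i → v M i ≡ 1 → w M i ≡ ∂
v≡1⇒∂ M i e with w M i | trans (sym (mdeg≡weight M (i ∸ 1))) e
... | ∂ | _ = refl

C≢∂ : C ≢ ∂
C≢∂ ()

-- Every ∂ of the word comes from d ↦ ∂C, so two ∂ are never adjacent …
no-∂∂ : ∀ M k → at C (word M) k ≡ ∂ → at C (word M) (suc k) ≡ ∂ → ⊥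
no-∂∂ (𝐜 ∷ M) (suc k)       e e′ = no-∂∂ M k e e′
no-∂∂ (𝐝 ∷ M) (suc (suc k)) e e′ = no-∂∂ M k e e′

-- … and in particular never occupies the last position.
∂-not-last : ∀ M k → at C (word M) k ≡ ∂ → suc (suc k) ≤ degree M
∂-not-last (𝐜 ∷ M) (suc k)       e = s≤s (∂-not-last M k e)
∂-not-last (𝐝 ∷ M) zero          e = s≤s (s≤s z≤n)
∂-not-last (𝐝 ∷ M) (suc (suc k)) e = s≤s (s≤s (∂-not-last M k e))

past-end : ∀ M k → degree M ≤ k → at C (word M) k ≡ C
past-end []      k             _                = refl
past-end (𝐜 ∷ M) (suc k)       (s≤s le)         = past-end M k le
past-end (𝐝 ∷ M) (suc (suc k)) (s≤s (s≤s le)) = past-end M k le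

-≤⇔≤+ : ∀ i j k → (i ℤ.- j) ℤ.≤ k ⇔ i ℤ.≤ k ℤ.+ j
-≤⇔≤+ i j k = mk⇔
  (λ h → subst (ℤ._≤ k ℤ.+ j) (//-rightDividesˡ j i) (ℤP.+-monoˡ-≤ j h))
  (λ h → subst ((i ℤ.- j) ℤ.≤_) (//-rightDividesʳ j k) (ℤP.+-monoˡ-≤ (ℤ.- j) h))

drop⇔ : ∀ a b c → (+ a ℤ.- + b) ℤ.≤ (+ c ℤ.+ + 1) ⇔ a ≤ b + suc c
drop⇔ a b c = mk⇔
  (λ h → ℤP.drop‿+≤+ (subst (+ a ℤ.≤_) sum≡ (Equivalence.to (-≤⇔≤+ (+ a) (+ b) _) h)))
  (λ h → Equivalence.from (-≤⇔≤+ (+ a) (+ b) _) (subst (+ a ℤ.≤_) (sym sum≡) (ℤ.+≤+ h)))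
  where
  sum≡ : (+ c ℤ.+ + 1) ℤ.+ + b ≡ + (b + suc c)
  sum≡ = cong +_ (trans (ℕP.+-comm (c + 1) b) (cong (λ t → b + t) (ℕP.+-comm c 1)))

drop-cong : ∀ {x y z x′ y′ z′ : ℤ} → x ≡ x′ → y ≡ y′ → z ≡ z′ →
            (x ℤ.- y) ℤ.≤ (z ℤ.+ + 1) → (x′ ℤ.- y′) ℤ.≤ (z′ ℤ.+ + 1)
drop-cong refl refl refl d = d

pred-< : ∀ {x y} → 0 < x → x ≤ y → x ∸ 1 < y
pred-< {suc x} _ le = le

nonzero-sum : ∀ i j → ¬ (i ≡ 0 × j ≡ 0) → 0 < i + j
nonzero-sum zero    zero    nz = ⊥-elim (nz (refl , refl))
nonzero-sum zero    (suc j) _  = s≤s z≤n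
nonzero-sum (suc i) j       _  = s≤s z≤n

downward-induction : (P : ℕ → Set) {n : ℕ} → P n →
                     (∀ m → suc m ≤ n → P (suc m) → P m) → ∀ m → m ≤ n → P m
downward-induction P {n} top step m m≤n = go (n ∸ m) m (ℕP.m+[n∸m]≡n m≤n)
  where
  go : ∀ d m → m + d ≡ n → P m
  go zero    m e = subst P (trans (sym e) (ℕP.+-identityʳ m)) top
  go (suc d) m e = step m (subst (suc m ≤_) e (ℕP.m<m+n m (s≤s z≤n)))
                          (go d (suc m) (trans (sym (ℕP.+-suc m d)) e))

pointwise⇔ext : ∀ {n} (f : Fin (suc n) → ℤ) (h : ℕ → ℕ) →
                (∀ j → f j ≡ + h (toℕ j)) ⇔ (∀ k → k ≤ n → ext f k ≡ + h k)
pointwise⇔ext {n} f h = mk⇔ to from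
  where
  to : (∀ j → f j ≡ + h (toℕ j)) → ∀ k → k ≤ n → ext f k ≡ + h k
  to H k le with k <? suc n
  ... | yes p = trans (H (fromℕ< p)) (cong (λ z → + h z) (FinP.toℕ-fromℕ< p))
  ... | no ¬p = ⊥-elim (¬p (s≤s le))

  ext-toℕ : ∀ j → ext f (toℕ j) ≡ f j
  ext-toℕ j with toℕ j <? suc n
  ... | yes p = cong f (FinP.fromℕ<-toℕ j p)
  ... | no ¬p = ⊥-elim (¬p (FinP.toℕ<n j))

  from : (∀ k → k ≤ n → ext f k ≡ + h k) → ∀ j → f j ≡ + h (toℕ j)
  from H j = trans (sym (ext-toℕ j)) (H (toℕ j) (FinP.toℕ≤pred[n] j))

record Admissibleℕ (n : ℕ) (M : Monomial) (g : ℕ → ℕ) : Set where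
  field
    value0  : g 0 ≡ 0
    valuen  : g n ≡ n
    bounded : ∀ i → i ≤ n → g i ≤ i
    rises   : ∀ m → suc m ≤ n → w M (suc m) ≡ C → g m < g (suc m)
    falls   : ∀ m → suc m ≤ n → w M (suc m) ≡ ∂ → g (suc m) ≤ g m
    drops   : ∀ m → suc (suc m) ≤ n → w M (suc (suc m)) ≡ ∂ →
              g (suc m) ≤ g (suc (suc m)) + suc (g m)

admissible-nonneg : ∀ {n M f} → Admissible n M f → ∀ k → k ≤ n → + 0 ℤ.≤ ext f k
admissible-nonneg A zero _ rewrite Admissible.at0 A = ℤ.+≤+ z≤n
admissible-nonneg A (suc k) le with ℕP.m≤n⇒m<n∨m≡n le
... | inj₂ refl rewrite Admissible.atn A = ℤ.+≤+ z≤n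
... | inj₁ lt   = proj₁ (Admissible.bounds A (suc k) (s≤s z≤n) (ℕP.<⇒≤pred lt))

module _ {n : ℕ} {M : Monomial} {f : Fin (suc n) → ℤ} (g : ℕ → ℕ)
         (f≡g : ∀ k → k ≤ n → ext f k ≡ + g k) where

  private
    ≤n : ∀ {m} → suc m ≤ n → m ≤ n
    ≤n = ℕP.<⇒≤

  admissible⇒ℕ : Admissible n M f → Admissibleℕ n M g
  admissible⇒ℕ A = record
    { value0  = g0
    ; valuen  = gn
    ; bounded = bounded
    ; rises   = λ m le wC → ℤP.drop‿+<+ (subst₂ ℤ._<_ (f≡g m (≤n le)) (f≡g (suc m) le)
                  (rise (suc m) (s≤s z≤n) le (w⇒v M (suc m) wC)))
    ; falls   = λ m le w∂ → ℤP.drop‿+≤+ (subst₂ ℤ._≤_ (f≡g (suc m) le) (f≡g m (≤n le))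
                  (fall (suc m) (s≤s z≤n) le (w⇒v M (suc m) w∂)))
    ; drops   = λ m le w∂ → Equivalence.to (drop⇔ _ _ _)
                  (drop-cong (f≡g (suc m) (≤n le)) (f≡g (suc (suc m)) le) (f≡g m (≤n (≤n le)))
                    (dropLim (suc (suc m)) (s≤s (s≤s z≤n)) le (w⇒v M (suc (suc m)) w∂)))
    }
    where
    open Admissible A
    g0 : g 0 ≡ 0
    g0 = ℤP.+-injective (trans (sym (f≡g 0 z≤n)) at0)
    gn : g n ≡ n
    gn = ℤP.+-injective (trans (sym (f≡g n ℕP.≤-refl)) atn)
    bounded : ∀ i → i ≤ n → g i ≤ i
    bounded zero    _  = ℕP.≤-reflexive g0
    bounded (suc i) le with ℕP.m≤n⇒m<n∨m≡n le
    ... | inj₂ refl = ℕP.≤-reflexive gn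
    ... | inj₁ lt   = ℤP.drop‿+≤+ (subst (ℤ._≤ + suc i) (f≡g (suc i) le)
                        (proj₂ (bounds (suc i) (s≤s z≤n) (ℕP.<⇒≤pred lt))))

  ℕ⇒admissible : Admissibleℕ n M g → Admissible n M f
  ℕ⇒admissible A = record
    { at0     = trans (f≡g 0 z≤n) (cong +_ value0)
    ; atn     = trans (f≡g n ℕP.≤-refl) (cong +_ valuen)
    ; bounds  = λ i _ le → let i≤n = ℕP.≤-trans le (ℕP.m∸n≤m n 1) in
                  subst (+ 0 ℤ.≤_) (sym (f≡g i i≤n)) (ℤ.+≤+ z≤n) ,
                  subst (ℤ._≤ + i) (sym (f≡g i i≤n)) (ℤ.+≤+ (bounded i i≤n))
    ; rise    = λ { (suc m) _ le v0 → subst₂ ℤ._<_ (sym (f≡g m (≤n le))) (sym (f≡g (suc m) le))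
                    (ℤ.+<+ (rises m le (v≡0⇒C M (suc m) v0))) }
    ; fall    = λ { (suc m) _ le v1 → subst₂ ℤ._≤_ (sym (f≡g (suc m) le)) (sym (f≡g m (≤n le)))
                    (ℤ.+≤+ (falls m le (v≡1⇒∂ M (suc m) v1))) }
    ; dropLim = λ { (suc zero) (s≤s ()) _ _
                  ; (suc (suc m)) _ le v1 →
                    drop-cong (sym (f≡g (suc m) (≤n le))) (sym (f≡g (suc (suc m)) le))
                      (sym (f≡g m (≤n (≤n le))))
                      (Equivalence.from (drop⇔ _ _ _) (drops m le (v≡1⇒∂ M (suc (suc m)) v1))) }
    }
    where open Admissibleℕ A

dim : Fan → ℕ
dim (ΠΣ k l) = k + l
dim (ΠΠ k l) = k + l

ΠΣ≢ΠΠ : ∀ {k l k′ l′} → ΠΣ k l ≢ ΠΠ k′ l′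
ΠΣ≢ΠΠ ()

ΠΣ-injective : ∀ {k l k′ l′} → ΠΣ k l ≡ ΠΣ k′ l′ → k ≡ k′
ΠΣ-injective refl = refl

ΠΠ-injective : ∀ {k l k′ l′} → ΠΠ k l ≡ ΠΠ k′ l′ → k ≡ k′ × l ≡ l′
ΠΠ-injective refl = refl , refl

step-dim : ∀ {x F c F′} → Step x F c F′ → dim F ≡ suc (dim F′)
step-dim (ruleI {k} {l} {suc i} _ i<k) =
  sym (ℕP.m+[n∸m]≡n (ℕP.≤-trans i<k (ℕP.m≤m+n k l)))
step-dim (ruleII {k} {l} {i} {j} i≤k j≤l nz) with i + j | nonzero-sum i j nz | ℕP.+-mono-≤ i≤k j≤l
... | suc t | _ | t<k+l = sym (ℕP.m+[n∸m]≡n t<k+l)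
step-dim (ruleIII {k} {l}) = ℕP.+-suc k l

module RunSequence {n : ℕ} {M : Monomial} (r : Run n M) where
  open Run r

  seq : ℕ → ℕ
  seq = seqOf r

  seq-below : ∀ j → j < n → seq j ≡ entry (choice (suc j)) (fan j) j (choice j)
  seq-below j j<n with j <? n
  ... | yes _  = refl
  ... | no j≮n = ⊥-elim (j≮n j<n)

  seq-top : seq n ≡ n
  seq-top with n <? n
  ... | yes n<n = ⊥-elim (ℕP.<-irrefl refl n<n)
  ... | no _    = refl

  dim-fan : ∀ m → m ≤ n → dim (fan m) ≡ m
  dim-fan = downward-induction (λ m → dim (fan m) ≡ m)
    (trans (cong dim start) (ℕP.+-identityʳ n))
    (λ m le ih → ℕP.suc-injective (trans (sym (step-dim (steps (suc m) (s≤s z≤n) le))) ih))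

  data StepAt (m : ℕ) : Set where
    byI   : ∀ {k l i} → 1 ≤ i → i ≤ k → w M (suc m) ≡ C → fan (suc m) ≡ ΠΣ k l →
            choice (suc m) ≡ one i → fan m ≡ ΠΣ (i ∸ 1) (k + l ∸ i) → StepAt m
    byII  : ∀ {k l i j} → i ≤ k → j ≤ l → ¬ (i ≡ 0 × j ≡ 0) → w M (suc m) ≡ C →
            fan (suc m) ≡ ΠΠ k l → choice (suc m) ≡ two i j →
            fan m ≡ ΠΣ (i + j ∸ 1) (k + l ∸ (i + j)) → StepAt m
    byIII : ∀ {k l} → w M (suc m) ≡ ∂ → fan (suc m) ≡ ΠΣ k (suc l) →
            choice (suc m) ≡ none → fan m ≡ ΠΠ k l → StepAt m

  stepAt : ∀ m → suc m ≤ n → StepAt m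
  stepAt m le = classify (steps (suc m) (s≤s z≤n) le) refl refl refl refl
    where
    classify : ∀ {x F c F′} → Step x F c F′ → w M (suc m) ≡ x → fan (suc m) ≡ F →
               choice (suc m) ≡ c → fan m ≡ F′ → StepAt m
    classify (ruleI 1≤i i≤k)      = byI 1≤i i≤k
    classify (ruleII i≤k j≤l nz) = byII i≤k j≤l nz
    classify ruleIII              = byIII

  seq-ΠΣ : ∀ j {k l} → j ≤ n → fan j ≡ ΠΣ k l → seq j ≡ k
  seq-ΠΣ j le e with ℕP.m≤n⇒m<n∨m≡n le
  ... | inj₂ refl = trans seq-top (ΠΣ-injective (trans (sym start) e))
  ... | inj₁ lt with stepAt j lt
  ...   | byI _ _ _ _ ec e′ rewrite seq-below j lt | ec = ΠΣ-injective (trans (sym e′) e)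
  ...   | byII _ _ _ _ _ ec e′ rewrite seq-below j lt | ec = ΠΣ-injective (trans (sym e′) e)
  ...   | byIII _ _ _ e′ = ⊥-elim (ΠΣ≢ΠΠ (trans (sym e) e′))

  entering-ΠΠ : ∀ j {k l} → j ≤ n → fan j ≡ ΠΠ k l → j < n × choice (suc j) ≡ none
  entering-ΠΠ j le e with ℕP.m≤n⇒m<n∨m≡n le
  ... | inj₂ refl = ⊥-elim (ΠΣ≢ΠΠ (trans (sym start) e))
  ... | inj₁ lt with stepAt j lt
  ...   | byI _ _ _ _ _ e′     = ⊥-elim (ΠΣ≢ΠΠ (trans (sym e′) e))
  ...   | byII _ _ _ _ _ _ e′  = ⊥-elim (ΠΣ≢ΠΠ (trans (sym e′) e))
  ...   | byIII _ _ ec _       = lt , ec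

  record LeaveΠΠ (m k l : ℕ) : Set where
    field
      a b     : ℕ
      a≤k     : a ≤ k
      b≤l     : b ≤ l
      nonzero : ¬ (a ≡ 0 × b ≡ 0)
      chosen  : choice (suc m) ≡ two a b
      next    : fan m ≡ ΠΣ (a + b ∸ 1) (k + l ∸ (a + b))

  leave-ΠΠ : ∀ m {k l} → suc m ≤ n → fan (suc m) ≡ ΠΠ k l → LeaveΠΠ m k l
  leave-ΠΠ m le e with stepAt m le
  ... | byI _ _ _ e′ _ _   = ⊥-elim (ΠΣ≢ΠΠ (trans (sym e′) e))
  ... | byIII _ e′ _ _     = ⊥-elim (ΠΣ≢ΠΠ (trans (sym e′) e))
  ... | byII {i = a} {j = b} a≤k b≤l nz _ e′ ec next with ΠΠ-injective (trans (sym e′) e)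
  ...   | refl , refl = record { a = a ; b = b ; a≤k = a≤k ; b≤l = b≤l ; nonzero = nz
                               ; chosen = ec ; next = next }

  seq-ΠΠ-0 : ∀ {k l} → fan 0 ≡ ΠΠ k l → seq 0 ≡ k
  seq-ΠΠ-0 e with entering-ΠΠ 0 z≤n e
  ... | lt , ec rewrite seq-below 0 lt | ec | e = refl

  seq-ΠΠ : ∀ m {k l a b} → suc m ≤ n → fan (suc m) ≡ ΠΠ k l → choice (suc m) ≡ two a b →
           seq (suc m) ≡ k + b
  seq-ΠΠ m le e ec with entering-ΠΠ (suc m) le e
  ... | lt , ec′ rewrite seq-below (suc m) lt | ec′ | e | ec = refl

  seq-ΠΠ-range : ∀ m {k l} → m ≤ n → fan m ≡ ΠΠ k l → k ≤ seq m × seq m ≤ k + l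
  seq-ΠΠ-range zero {k} {l} _ e rewrite seq-ΠΠ-0 e = ℕP.≤-refl , ℕP.m≤m+n k l
  seq-ΠΠ-range (suc m) {k} le e with leave-ΠΠ m le e
  ... | record { b = b ; b≤l = b≤l ; chosen = ec } rewrite seq-ΠΠ m le e ec =
    ℕP.m≤m+n k b , ℕP.+-monoʳ-≤ k b≤l

  -- The sequence is bounded by the dimension of the fan, that is, by j.
  seq-bounded : ∀ j → j ≤ n → seq j ≤ j
  seq-bounded j le = subst (seq j ≤_) (dim-fan j le) (seq≤dim (fan j) refl)
    where
    seq≤dim : ∀ F → fan j ≡ F → seq j ≤ dim F
    seq≤dim (ΠΣ k l) e = subst (_≤ k + l) (sym (seq-ΠΣ j le e)) (ℕP.m≤m+n k l)
    seq≤dim (ΠΠ k l) e = proj₂ (seq-ΠΠ-range j le e)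

  seq-rises : ∀ m → suc m ≤ n → w M (suc m) ≡ C → seq m < seq (suc m)
  seq-rises m le wC with stepAt m le
  ... | byI {i = suc i} _ i<k _ eF _ eF′
    rewrite seq-ΠΣ (suc m) le eF | seq-ΠΣ m (ℕP.<⇒≤ le) eF′ = i<k
  ... | byII {k} {l} {i} {j} i≤k _ nz _ eF ec eF′
    rewrite seq-ΠΠ m le eF ec | seq-ΠΣ m (ℕP.<⇒≤ le) eF′ =
    pred-< (nonzero-sum i j nz) (ℕP.+-monoˡ-≤ j i≤k)
  ... | byIII w∂ _ _ _ = ⊥-elim (C≢∂ (trans (sym wC) w∂))

  seq-falls : ∀ m → suc m ≤ n → w M (suc m) ≡ ∂ → seq (suc m) ≤ seq m
  seq-falls m le w∂ with stepAt m le
  ... | byI _ _ wC _ _ _        = ⊥-elim (C≢∂ (trans (sym wC) w∂))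
  ... | byII _ _ _ wC _ _ _     = ⊥-elim (C≢∂ (trans (sym wC) w∂))
  ... | byIII _ eF _ eF′ rewrite seq-ΠΣ (suc m) le eF = proj₁ (seq-ΠΠ-range m (ℕP.<⇒≤ le) eF′)

  -- Across Π_k × σ_{l+1} →(iii) Π_k × Π_l →(ii, choice (a , b)) F_m the values
  -- are k, k + b and a + b - 1, and b ≤ a + b.
  seq-drops : ∀ m → suc (suc m) ≤ n → w M (suc (suc m)) ≡ ∂ →
              seq (suc m) ≤ seq (suc (suc m)) + suc (seq m)
  seq-drops m le w∂ with stepAt (suc m) le
  ... | byI _ _ wC _ _ _    = ⊥-elim (C≢∂ (trans (sym wC) w∂))
  ... | byII _ _ _ wC _ _ _ = ⊥-elim (C≢∂ (trans (sym wC) w∂))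
  ... | byIII {k} _ eF _ eF′ with leave-ΠΠ m (ℕP.<⇒≤ le) eF′
  ...   | record { a = a ; b = b ; chosen = ec ; next = next }
    rewrite seq-ΠΣ (suc (suc m)) le eF | seq-ΠΠ m (ℕP.<⇒≤ le) eF′ ec
          | seq-ΠΣ m (ℕP.≤-trans (ℕP.n≤1+n m) (ℕP.<⇒≤ le)) next =
    ℕP.+-monoʳ-≤ k (ℕP.≤-trans (ℕP.m≤n+m b a) (≤suc-pred (a + b)))
    where
    ≤suc-pred : ∀ x → x ≤ suc (x ∸ 1)
    ≤suc-pred zero    = z≤n
    ≤suc-pred (suc x) = ℕP.≤-refl

  run-admissible : Admissibleℕ n M seq
  run-admissible = record
    { value0  = ℕP.n≤0⇒n≡0 (seq-bounded 0 z≤n)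
    ; valuen  = seq-top
    ; bounded = seq-bounded
    ; rises   = seq-rises
    ; falls   = seq-falls
    ; drops   = seq-drops
    }

-- The three rules, with the target fan given up to equality of its indices.
ruleI≡ : ∀ {k l i k′ l′} → 1 ≤ i → i ≤ k → i ∸ 1 ≡ k′ → k + l ∸ i ≡ l′ →
         Step C (ΠΣ k l) (one i) (ΠΣ k′ l′)
ruleI≡ 1≤i i≤k refl refl = ruleI 1≤i i≤k

ruleII≡ : ∀ {k l i j k′ l′} → i ≤ k → j ≤ l → ¬ (i ≡ 0 × j ≡ 0) →
          i + j ∸ 1 ≡ k′ → k + l ∸ (i + j) ≡ l′ → Step C (ΠΠ k l) (two i j) (ΠΣ k′ l′)
ruleII≡ i≤k j≤l nz refl refl = ruleII i≤k j≤l nz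

ruleIII≡ : ∀ {k l l′} → l ≡ suc l′ → Step ∂ (ΠΣ k l) none (ΠΠ k l′)
ruleIII≡ refl = ruleIII

module Construction {n : ℕ} {M : Monomial} {g : ℕ → ℕ}
                    (deg : degree M ≡ n) (A : Admissibleℕ n M g) where
  open Admissibleℕ A

  descent : ℕ → ℕ
  descent m = g (suc m) ∸ g (suc (suc m))

  fanAt : Letter → ℕ → Fan
  fanAt C m = ΠΣ (g m) (m ∸ g m)
  fanAt ∂ m = ΠΠ (g (suc m)) (m ∸ g (suc m))

  choiceAt : Letter → Letter → ℕ → Choice
  choiceAt C C m = one (suc (g m))
  choiceAt C ∂ m = two (suc (g m) ∸ descent m) (descent m)
  choiceAt ∂ _ m = none

  fans : ℕ → Fan
  fans m = fanAt (w M (suc m)) m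

  choices : ℕ → Choice
  choices zero    = none
  choices (suc m) = choiceAt (w M (suc m)) (w M (suc (suc m))) m

  ∂-room : ∀ m → w M (suc m) ≡ ∂ → suc (suc m) ≤ n
  ∂-room m e = subst (suc (suc m) ≤_) deg (∂-not-last M m e)

  -- By the drop condition the rule-(ii) choice at C∂ has sum g m + 1.
  choice-sum : ∀ m → suc (suc m) ≤ n → w M (suc (suc m)) ≡ ∂ →
               (suc (g m) ∸ descent m) + descent m ≡ suc (g m)
  choice-sum m le w∂ =
    ℕP.m∸n+n≡m (ℕP.m≤n+o⇒m∸n≤o (g (suc m)) (g (suc (suc m))) (drops m le w∂))

  -- Past the word the letter is C, so F_n = Π_{g n} × σ_{n - g n} = Π_n × σ_0.
  fans-start : fans n ≡ ΠΣ n 0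
  fans-start rewrite past-end M n (ℕP.≤-reflexive deg) | valuen | ℕP.n∸n≡0 n = refl

  step-C∂ : ∀ m → suc m ≤ n → w M (suc m) ≡ C → w M (suc (suc m)) ≡ ∂ →
            Step C (fanAt ∂ (suc m)) (choiceAt C ∂ m) (fanAt C m)
  step-C∂ m le wC w∂ =
    ruleII≡ a≤ b≤ nonzero (cong (_∸ 1) sum) (cong₂ _∸_ (ℕP.m+[n∸m]≡n g₂≤) sum)
    where
    le₂ : suc (suc m) ≤ n
    le₂ = ℕP.≤-trans (ℕP.n≤1+n (suc (suc m))) (∂-room (suc m) w∂)
    sum : (suc (g m) ∸ descent m) + descent m ≡ suc (g m)
    sum = choice-sum m le₂ w∂
    fall : g (suc (suc m)) ≤ g (suc m)
    fall = falls (suc m) le₂ w∂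
    g₂≤ : g (suc (suc m)) ≤ suc m
    g₂≤ = ℕP.≤-trans fall (bounded (suc m) le)
    a≤ : suc (g m) ∸ descent m ≤ g (suc (suc m))
    a≤ = subst (suc (g m) ∸ descent m ≤_) (ℕP.m∸[m∸n]≡n fall)
           (ℕP.∸-monoˡ-≤ (descent m) (rises m le wC))
    b≤ : descent m ≤ suc m ∸ g (suc (suc m))
    b≤ = ℕP.∸-monoˡ-≤ (g (suc (suc m))) (bounded (suc m) le)
    nonzero : ¬ ((suc (g m) ∸ descent m) ≡ 0 × descent m ≡ 0)
    nonzero (a≡0 , b≡0) with trans (sym sum) (cong₂ _+_ a≡0 b≡0)
    ... | ()

  step-valid : ∀ m x y → w M (suc m) ≡ x → w M (suc (suc m)) ≡ y → suc m ≤ n →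
               Step x (fanAt y (suc m)) (choiceAt x y m) (fanAt x m)
  step-valid m C C wC _  le = ruleI≡ (s≤s z≤n) (rises m le wC) refl
    (cong (_∸ suc (g m)) (ℕP.m+[n∸m]≡n (bounded (suc m) le)))
  step-valid m C ∂ wC w∂ le = step-C∂ m le wC w∂
  step-valid m ∂ C w∂ _  le = ruleIII≡ (ℕP.+-∸-assoc 1 g₁≤m)
    where
    g₁≤m : g (suc m) ≤ m
    g₁≤m = ℕP.≤-trans (falls m le w∂) (bounded m (ℕP.<⇒≤ le))
  step-valid m ∂ ∂ w∂ w∂′ _ = ⊥-elim (no-∂∂ M m w∂ w∂′)

  run : Run n M
  run = record
    { fan    = fans
    ; choice = choices
    ; start  = fans-start
    ; steps  = λ { (suc m) _ le → step-valid m _ _ refl refl le }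
    }

  -- The entry read off at position j < n is g j.  At a ∂ the fan is
  -- Π_{g(j+1)} × Π, left by the C∂-choice with second coordinate g j - g(j+1).
  entry-valid : ∀ j x → w M (suc j) ≡ x → suc j ≤ n →
                entry (choiceAt x (w M (suc (suc j))) j) (fanAt x j) j (choices j) ≡ g j
  entry-valid j C wC le with w M (suc (suc j)) in e
  ... | C = refl
  ... | ∂ = cong (_∸ 1) (choice-sum j (ℕP.≤-trans (ℕP.n≤1+n (suc (suc j))) (∂-room (suc j) e)) e)
  entry-valid zero ∂ w∂ le =
    trans (ℕP.n≤0⇒n≡0 (subst (g 1 ≤_) value0 (falls 0 le w∂))) (sym value0)
  entry-valid (suc j) ∂ w∂ le with w M (suc j) in e
  ... | C rewrite w∂ = ℕP.m+[n∸m]≡n (falls (suc j) le w∂)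
  ... | ∂ = ⊥-elim (no-∂∂ M j e w∂)

  seq-run : ∀ j → j ≤ n → seqOf run j ≡ g j
  seq-run j le with j <? n
  ... | yes lt = entry-valid j _ refl lt
  ... | no  j≮n with ℕP.m≤n⇒m<n∨m≡n le
  ...   | inj₁ lt   = ⊥-elim (j≮n lt)
  ...   | inj₂ refl = sym valuen

-- Lemma 3.2.  Admissible functions are exactly the integer sequences of runs.
lemma3p2 : (n : ℕ) → 1 ≤ n → (M : Monomial) → degree M ≡ n →
           (f : Fin (suc n) → ℤ) →
           Admissible n M f ⇔ ∃ (λ (r : Run n M) → ∀ (j : Fin (suc n)) → f j ≡ + seqOf r (toℕ j))
lemma3p2 n _ M deg f = mk⇔ admissible⇒run run⇒admissible
  where
  -- An admissible f is ℕ-valued; the run built from g = ∣f∣ has sequence g.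
  admissible⇒run : Admissible n M f →
                   ∃ (λ (r : Run n M) → ∀ (j : Fin (suc n)) → f j ≡ + seqOf r (toℕ j))
  admissible⇒run A = run , Equivalence.from (pointwise⇔ext f (seqOf run)) f≡seq
    where
    g : ℕ → ℕ
    g k = ℤ.∣ ext f k ∣

    f≡g : ∀ k → k ≤ n → ext f k ≡ + g k
    f≡g k le = sym (ℤP.0≤i⇒+∣i∣≡i (admissible-nonneg A k le))

    open Construction deg (admissible⇒ℕ g f≡g A)

    f≡seq : ∀ k → k ≤ n → ext f k ≡ + seqOf run k
    f≡seq k le = trans (f≡g k le) (cong +_ (sym (seq-run k le)))

  -- The sequence of a run is ℕ-admissible, hence so is f.
  run⇒admissible : ∃ (λ (r : Run n M) → ∀ (j : Fin (suc n)) → f j ≡ + seqOf r (toℕ j)) →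
                   Admissible n M f
  run⇒admissible (r , f≡seq) =
    ℕ⇒admissible (seqOf r) (Equivalence.to (pointwise⇔ext f (seqOf r)) f≡seq)
      (RunSequence.run-admissible r)
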